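{- Let $(x,z)$ be a feasible solution of the Label-LP for a Directed Multicut instance $(G,H)$. Then for every edge $e=(u,v)$ of $G$ and every $i\in\{1,\dots,k\}$, $$x_e \ \ge\ \sum_{\sigma\in L:\ \sigma[i]=1} z_{u,\sigma} \;-\; \sum_{\sigma\in L:\ \sigma[i]=1} z_{v,\sigma}.$$
   Context: Directed Multicut instance: directed supply graph $G=(V_G,E)$ with nonnegative edge weights $w_e$, directed simple demand graph $H$ with vertex set $V_H=\{s_1,\dots,s_k\}\subseteq V_G$ and edge set $E_H$. Label-LP: let $L=\{0,1\}^k$, with $\sigma[i]$ the $i$-th bit of $\sigma\in L$ and $\sigma_1\le\sigma_2$ iff $\sigma_1[i]\le\sigma_2[i]$ for all $i$. Variables $z_{v,\sigma}$ ($v\in V_G,\sigma\in L$), $z_{e,\sigma_1\sigma_2}$ ($e\in E,\sigma_1,\sigma_2\in L$), $x_e$ ($e\in E$). Constraints: $\sum_{\sigma\in L} z_{v,\sigma}=1$ for all $v$; $z_{s_i,\sigma}=0$ whenever $\sigma[i]=0$; $z_{s_j,\sigma}=0$ whenever $(s_i,s_j)\in E_H$ and $\sigma[i]=1$; for every $e=(u,v)\in E$: $\sum_{\sigma_2} z_{e,\sigma_1\sigma_2}=z_{u,\sigma_1}$ for all $\sigma_1$, $\sum_{\sigma_1} z_{e,\sigma_1\sigma_2}=z_{v,\sigma_2}$ for all $\sigma_2$, and $x_e=\sum_{\sigma_1\not\le\sigma_2} z_{e,\sigma_1\sigma_2}$; all $z$ variables in $[0,1]$. Objective: minimize $\sum_e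 w_e x_e$.
   Formalization: The Label-LP variables $z_{v,\sigma}$, $z_{e,\sigma_1\sigma_2}$ and $x_e$, as well as the edge weights $w_e$, take values in the rationals. -}

module Defs where

open import Data.Nat using (ℕ; zero; suc)
open import Data.Bool using (Bool; true; false; _∧_; _∨_; not; if_then_else_)
open import Data.Vec using (Vec; []; _∷_; lookup)
open import Data.Fin using (Fin)
open import Data.List using (List; []; _∷_; map; _++_)
open import Data.Rational using (ℚ; 0ℚ; 1ℚ; _+_; _≤_)
open import Data.Empty using (⊥)
open import Relation.Binary.PropositionalEquality using (_≡_)
open import Function.Definitions using (Injective)

-- Labels σ ∈ L = {0,1}^k, represented as Boolean vectors (true = bit 1).
Label : ℕ → Set
Label k = Vec Bool k

allLabels : (k : ℕ) → List (Label k)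
allLabels zero = [] ∷ []
allLabels (suc k) = map (false ∷_) (allLabels k) ++ map (true ∷_) (allLabels k)

sumOver : {A : Set} → List A → (A → ℚ) → ℚ
sumOver [] f = 0ℚ
sumOver (a ∷ as) f = f a + sumOver as f

leqB : {k : ℕ} → Label k → Label k → Bool
leqB [] [] = true
leqB (a ∷ as) (b ∷ bs) = (not a ∨ b) ∧ leqB as bs

-- Directed Multicut instance: supply graph with vertices Fin n and edges Fin m
-- (edge e goes from src e to tgt e), nonnegative weights; demand graph H on
-- k distinct terminals s₁..s_k with a simple (loopless) edge relation.
record Instance (n m k : ℕ) : Set₁ where
  field
    src tgt    : Fin m → Fin n
    w          : Fin m → ℚ
    w-nonneg   : ∀ e → 0ℚ ≤ w e
    term       : Fin k → Fin n
    term-inj   : Injective _≡_ _≡_ term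
    DemEdge    : Fin k → Fin k → Set
    dem-noloop : ∀ i → DemEdge i i → ⊥

record Feasible {n m k : ℕ} (I : Instance n m k)
                (zV : Fin n → Label k → ℚ)
                (zE : Fin m → Label k → Label k → ℚ)
                (x : Fin m → ℚ) : Set where
  open Instance I
  field
    zV-lo    : ∀ v σ → 0ℚ ≤ zV v σ
    zV-hi    : ∀ v σ → zV v σ ≤ 1ℚ
    zE-lo    : ∀ e σ₁ σ₂ → 0ℚ ≤ zE e σ₁ σ₂
    zE-hi    : ∀ e σ₁ σ₂ → zE e σ₁ σ₂ ≤ 1ℚ
    zV-sum   : ∀ v → sumOver (allLabels k) (zV v) ≡ 1ℚ
    term-own : ∀ i σ → lookup σ i ≡ false → zV (term i) σ ≡ 0ℚ
    term-dem : ∀ i j σ → DemEdge i j → lookup σ i ≡ true → zV (term j) σ ≡ 0ℚ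
    marg-src : ∀ e σ₁ → sumOver (allLabels k) (λ σ₂ → zE e σ₁ σ₂) ≡ zV (src e) σ₁
    marg-tgt : ∀ e σ₂ → sumOver (allLabels k) (λ σ₁ → zE e σ₁ σ₂) ≡ zV (tgt e) σ₂
    x-def    : ∀ e → x e ≡ sumOver (allLabels k) (λ σ₁ → sumOver (allLabels k)
                 (λ σ₂ → if leqB σ₁ σ₂ then 0ℚ else zE e σ₁ σ₂))

massOn : {n k : ℕ} → (Fin n → Label k → ℚ) → Fin n → Fin k → ℚ
massOn {k = k} zV v i = sumOver (allLabels k) (λ σ → if lookup σ i then zV v σ else 0ℚ)

-- Push both vertex masses onto the edge distribution z_e through its two marginal constraints:
-- the mass of u on bit i is the z_e-mass of pairs (σ₁, σ₂) with σ₁[i] = 1, that of v the mass of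
-- pairs with σ₂[i] = 1. A pair counted for u but not for v has σ₁[i] = 1 and σ₂[i] = 0, hence
-- σ₁ ≰ σ₂, so it is counted in x_e; summing this pointwise inequality over all pairs gives the claim.
module Submission where

open import Defs
open import Data.Nat using (ℕ)
open import Data.Fin using (Fin; zero; suc)
open import Data.Rational using (ℚ; 0ℚ; _+_; -_; _-_; _≤_)
open import Data.Rational.Properties
  using (≤-refl; ≤-reflexive; +-mono-≤; +-monoˡ-≤; +-identityˡ; +-identityʳ;
         +-0-group; +-0-commutativeMonoid; module ≤-Reasoning)
open import Data.Bool using (Bool; true; false; _∨_; not; if_then_else_)
open import Data.Bool.Properties using (∧-zeroʳ)
open import Data.Vec using (_∷_; lookup)
open import Data.List using (List; []; _∷_)
open import Algebra.Bundles using (CommutativeMonoid)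
open import Algebra.Properties.CommutativeSemigroup
  (CommutativeMonoid.commutativeSemigroup +-0-commutativeMonoid) using (interchange)
open import Algebra.Properties.Group +-0-group using (//-rightDividesʳ)
open import Relation.Binary.PropositionalEquality
  using (_≡_; refl; sym; trans; cong; cong₂; subst₂; module ≡-Reasoning)

module _ {A : Set} where

  sumOver-cong : (l : List A) {f g : A → ℚ} → (∀ a → f a ≡ g a) → sumOver l f ≡ sumOver l g
  sumOver-cong []      f≗g = refl
  sumOver-cong (a ∷ l) f≗g = cong₂ _+_ (f≗g a) (sumOver-cong l f≗g)

  sumOver-mono : (l : List A) {f g : A → ℚ} → (∀ a → f a ≤ g a) → sumOver l f ≤ sumOver l g
  sumOver-mono []      f≤g = ≤-refl
  sumOver-mono (a ∷ l) f≤g = +-mono-≤ (f≤g a) (sumOver-mono l f≤g)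

  sumOver-zero : (l : List A) → sumOver l (λ _ → 0ℚ) ≡ 0ℚ
  sumOver-zero []      = refl
  sumOver-zero (_ ∷ l) = trans (cong (0ℚ +_) (sumOver-zero l)) (+-identityˡ 0ℚ)

  sumOver-+ : (l : List A) (f g : A → ℚ) →
              sumOver l (λ a → f a + g a) ≡ sumOver l f + sumOver l g
  sumOver-+ []      f g = sym (+-identityˡ 0ℚ)
  sumOver-+ (a ∷ l) f g =
    trans (cong (f a + g a +_) (sumOver-+ l f g)) (interchange (f a) (g a) _ _)

  sumOver-if : (l : List A) (b : Bool) (f : A → ℚ) →
               (if b then sumOver l f else 0ℚ) ≡ sumOver l (λ a → if b then f a else 0ℚ)
  sumOver-if l true  f = refl
  sumOver-if l false f = sym (sumOver-zero l)

sumOver-comm : {A B : Set} (l : List A) (l′ : List B) (f : A → B → ℚ) →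
               sumOver l (λ a → sumOver l′ (f a)) ≡ sumOver l′ (λ b → sumOver l (λ a → f a b))
sumOver-comm []      l′ f = sym (sumOver-zero l′)
sumOver-comm (a ∷ l) l′ f =
  trans (cong (sumOver l′ (f a) +_) (sumOver-comm l l′ f))
        (sym (sumOver-+ l′ (f a) (λ b → sumOver l (λ a → f a b))))

leqB-false : {k : ℕ} (i : Fin k) (σ₁ σ₂ : Label k) →
             lookup σ₁ i ≡ true → lookup σ₂ i ≡ false → leqB σ₁ σ₂ ≡ false
leqB-false zero    (true ∷ σ₁) (false ∷ σ₂) refl refl = refl
leqB-false (suc i) (a ∷ σ₁)    (b ∷ σ₂)     p    q
  rewrite leqB-false i σ₁ σ₂ p q = ∧-zeroʳ (not a ∨ b)

if-0-nonneg : (b : Bool) {z : ℚ} → 0ℚ ≤ z → 0ℚ ≤ (if b then 0ℚ else z)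
if-0-nonneg true  _   = ≤-refl
if-0-nonneg false 0≤z = 0≤z

bit-transfer : (a b c : Bool) {z : ℚ} → 0ℚ ≤ z → (a ≡ true → b ≡ false → c ≡ false) →
               (if a then z else 0ℚ) ≤ (if c then 0ℚ else z) + (if b then z else 0ℚ)
bit-transfer false false c 0≤z _ = +-mono-≤ (if-0-nonneg c 0≤z) ≤-refl
bit-transfer false true  c 0≤z _ = +-mono-≤ (if-0-nonneg c 0≤z) 0≤z
bit-transfer true  false c {z} _ cut rewrite cut refl refl = ≤-reflexive (sym (+-identityʳ z))
bit-transfer true  true  c {z} 0≤z _ =
  subst₂ _≤_ (+-identityˡ z) refl (+-monoˡ-≤ z (if-0-nonneg c 0≤z))

≤-+⇒-≤ : {p q r : ℚ} → p ≤ q + r → p - r ≤ q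
≤-+⇒-≤ {p} {q} {r} p≤q+r = begin
  p - r        ≤⟨ +-monoˡ-≤ (- r) p≤q+r ⟩
  q + r - r    ≡⟨ //-rightDividesʳ r q ⟩
  q            ∎
  where open ≤-Reasoning

module _ {n m k : ℕ} {I : Instance n m k}
         {zV : Fin n → Label k → ℚ} {zE : Fin m → Label k → Label k → ℚ} {x : Fin m → ℚ}
         (F : Feasible I zV zE x) (e : Fin m) (i : Fin k) where

  open Feasible F
  open Instance I using (src; tgt)
  open ≡-Reasoning

  private
    S : List (Label k)
    S = allLabels k

  massOn-src : massOn zV (src e) i ≡
               sumOver S (λ σ₁ → sumOver S (λ σ₂ → if lookup σ₁ i then zE e σ₁ σ₂ else 0ℚ))
  massOn-src = sumOver-cong S λ σ₁ → begin
    (if lookup σ₁ i then zV (src e) σ₁ else 0ℚ)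
      ≡⟨ cong (λ q → if lookup σ₁ i then q else 0ℚ) (sym (marg-src e σ₁)) ⟩
    (if lookup σ₁ i then sumOver S (zE e σ₁) else 0ℚ)
      ≡⟨ sumOver-if S (lookup σ₁ i) (zE e σ₁) ⟩
    sumOver S (λ σ₂ → if lookup σ₁ i then zE e σ₁ σ₂ else 0ℚ) ∎

  massOn-tgt : massOn zV (tgt e) i ≡
               sumOver S (λ σ₁ → sumOver S (λ σ₂ → if lookup σ₂ i then zE e σ₁ σ₂ else 0ℚ))
  massOn-tgt = begin
    massOn zV (tgt e) i
      ≡⟨ sumOver-cong S (λ σ₂ → cong (λ q → if lookup σ₂ i then q else 0ℚ) (sym (marg-tgt e σ₂))) ⟩
    sumOver S (λ σ₂ → if lookup σ₂ i then sumOver S (λ σ₁ → zE e σ₁ σ₂) else 0ℚ)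
      ≡⟨ sumOver-cong S (λ σ₂ → sumOver-if S (lookup σ₂ i) (λ σ₁ → zE e σ₁ σ₂)) ⟩
    sumOver S (λ σ₂ → sumOver S (λ σ₁ → if lookup σ₂ i then zE e σ₁ σ₂ else 0ℚ))
      ≡⟨ sym (sumOver-comm S S (λ σ₁ σ₂ → if lookup σ₂ i then zE e σ₁ σ₂ else 0ℚ)) ⟩
    sumOver S (λ σ₁ → sumOver S (λ σ₂ → if lookup σ₂ i then zE e σ₁ σ₂ else 0ℚ)) ∎

  cut-plus-massOn-tgt :
    sumOver S (λ σ₁ → sumOver S (λ σ₂ →
      (if leqB σ₁ σ₂ then 0ℚ else zE e σ₁ σ₂) + (if lookup σ₂ i then zE e σ₁ σ₂ else 0ℚ)))
    ≡ x e + massOn zV (tgt e) i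
  cut-plus-massOn-tgt = begin
    _ ≡⟨ sumOver-cong S (λ σ₁ → sumOver-+ S _ _) ⟩
    _ ≡⟨ sumOver-+ S _ _ ⟩
    _ ≡⟨ sym (cong₂ _+_ (x-def e) massOn-tgt) ⟩
    _ ∎

  massOn-src≤cut+massOn-tgt : massOn zV (src e) i ≤ x e + massOn zV (tgt e) i
  massOn-src≤cut+massOn-tgt = subst₂ _≤_ (sym massOn-src) cut-plus-massOn-tgt
    (sumOver-mono S λ σ₁ → sumOver-mono S λ σ₂ →
      bit-transfer (lookup σ₁ i) (lookup σ₂ i) (leqB σ₁ σ₂) (zE-lo e σ₁ σ₂) (leqB-false i σ₁ σ₂))

lemma1 : {n m k : ℕ} (I : Instance n m k)
         (zV : Fin n → Label k → ℚ) (zE : Fin m → Label k → Label k → ℚ) (x : Fin m → ℚ) →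
         Feasible I zV zE x →
         (e : Fin m) (i : Fin k) →
         massOn zV (Instance.src I e) i - massOn zV (Instance.tgt I e) i ≤ x e
lemma1 I zV zE x F e i = ≤-+⇒-≤ (massOn-src≤cut+massOn-tgt F e i)
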